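{- Let $g_1,g_2$ be polynomials with integer coefficients, $G=(g_1,g_2)$, $m_1,m_2\in\mathbb{N}$, and $M\in\mathbb{N}$ a multiple of $\operatorname{lcm}[m_1,m_2]$. Then \[ \frac{1}{\phi(M)}\sum_{\substack{k=1\\ \gcd(k,M)=1}}^{M}\gcd(g_1(k),m_1)\gcd(g_2(k),m_2)=\sum_{d_1\mid m_1,\,d_2\mid m_2}\phi(\gcd(d_1,d_2))\,\eta_G(d_1,d_2). \]
   Context: $\mathbb{N}=\{1,2,\ldots\}$; $\phi$ is Euler's totient function. $\eta_G(d_1,d_2)$ is the number of residues $x$ modulo $\operatorname{lcm}[d_1,d_2]$ with $g_1(x)\equiv 0\pmod{d_1}$, $g_2(x)\equiv0\pmod{d_2}$, $\gcd(x,d_1)=1$ and $\gcd(x,d_2)=1$. -}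

module Defs where

open import Data.Nat using (ℕ; zero; suc; _+_; _*_)
open import Data.Nat.Divisibility using (_∣_; _∣?_)
open import Data.Nat.GCD using (gcd)
open import Data.Nat.LCM using (lcm)
open import Data.Integer as ℤ using (ℤ; ∣_∣)
open import Data.List using (List; []; _∷_; length; filter; map; upTo)
open import Data.Nat.ListAction using (sum)
open import Data.Product using (_×_)
open import Relation.Binary.PropositionalEquality using (_≡_)
open import Relation.Nullary.Decidable using (_×-dec_)
open import Data.Nat.Properties using (_≟_)

-- A polynomial with integer coefficients, as its coefficient list
-- [a₀, a₁, …, aₙ] representing a₀ + a₁ x + … + aₙ xⁿ.
Poly : Set
Poly = List ℤ

eval : Poly → ℤ → ℤ
eval []       x = ℤ.+ 0
eval (a ∷ as) x = a ℤ.+ x ℤ.* eval as x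

evalℕ : Poly → ℕ → ℤ
evalℕ g k = eval g (ℤ.+ k)

φ : ℕ → ℕ
φ n = length (filter (λ k → gcd k n ≟ 1) (map suc (upTo n)))

sumDivisors : ℕ → (ℕ → ℕ) → ℕ
sumDivisors m f = sum (map f (filter (λ d → d ∣? m) (map suc (upTo m))))

-- η_G(d₁,d₂): number of residues x mod lcm[d₁,d₂] (x ∈ {0,…,lcm−1}) with
-- g₁(x) ≡ 0 (mod d₁), g₂(x) ≡ 0 (mod d₂), gcd(x,d₁) = 1, gcd(x,d₂) = 1.
-- (Integer divisibility d ∣ g(x) is, as in the standard library, d ∣ |g(x)|.)
η : Poly → Poly → ℕ → ℕ → ℕ
η g₁ g₂ d₁ d₂ =
  length (filter
    (λ x → (d₁ ∣? (∣ evalℕ g₁ x ∣)) ×-dec (d₂ ∣? (∣ evalℕ g₂ x ∣))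
            ×-dec (gcd x d₁ ≟ 1) ×-dec (gcd x d₂ ≟ 1))
    (upTo (lcm d₁ d₂)))

lhsSum : Poly → Poly → ℕ → ℕ → ℕ → ℕ
lhsSum g₁ g₂ m₁ m₂ M =
  sum (map (λ k → gcd (∣ evalℕ g₁ k ∣) m₁ * gcd (∣ evalℕ g₂ k ∣) m₂)
           (filter (λ k → gcd k M ≟ 1) (map suc (upTo M))))

rhsSum : Poly → Poly → ℕ → ℕ → ℕ
rhsSum g₁ g₂ m₁ m₂ =
  sumDivisors m₁ (λ d₁ → sumDivisors m₂ (λ d₂ → φ (gcd d₁ d₂) * η g₁ g₂ d₁ d₂))

-- Write S_N(f) = Σ_{k<N, (k,N)=1} f(k) for the sum of f over the reduced
-- residues mod N.  Gauss' identity Σ_{d∣n} φ(d) = n gives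
-- (a,m) = Σ_{d∣m, d∣a} φ(d); expanding both gcds this way and exchanging sums turns
-- the left side into Σ_{d₁,d₂} φ(d₁)φ(d₂) S_M(P_{d₁d₂}), where P_{d₁d₂}(k) is the
-- indicator of d₁ ∣ g₁(k) ∧ d₂ ∣ g₂(k).  This P is periodic mod L = lcm[d₁,d₂],
-- and S_L(P) = η_G(d₁,d₂).  Two facts about S finish the proof:
--   * lifting: for f periodic mod L and L ∣ M, S_M(f)·φ(L) = φ(M)·S_L(f);
--   * φ(lcm[d₁,d₂])·φ(gcd(d₁,d₂)) = φ(d₁)·φ(d₂).
-- Both come from one prime step: for p prime and f periodic mod N,
-- S_{pN}(f) = r_p(N)·S_N(f) with r_p(N) = p if p ∣ N and p − 1 otherwise,
-- iterated along the prime factorisation of M/L.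
module Submission where

open import Defs
open import Data.Nat
open import Data.Nat.Properties
open import Data.Nat.Divisibility
open import Data.Nat.DivMod using (_%_; _/_; m≡m%n+[m/n]*n; m%n<n)
open import Data.Nat.GCD
open import Data.Nat.LCM
open import Data.Nat.Coprimality as Coprime
  using (Coprime; coprime⇒gcd≡1; gcd≡1⇒coprime; coprime-divisor; coprime-Bézout)
open import Data.Nat.Primality using (Prime; prime⇒irreducible; euclidsLemma)
open import Data.Nat.Primality.Factorisation using (factorise; PrimeFactorisation)
open import Data.Nat.ListAction using (sum; product)
open import Data.Nat.Tactic.RingSolver using (solve-∀)
import Algebra.Properties.CommutativeSemigroup *-commutativeSemigroup as *-CS
open import Data.Integer as ℤ using (ℤ)
import Data.Integer.Properties as ℤ
import Data.Integer.Divisibility.Signed as ℤ∣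
import Data.Integer.Tactic.RingSolver as ℤ-Solver
open import Data.List using (List; []; _∷_; length; filter; map; upTo; applyUpTo)
open import Data.List.Properties using (map-upTo)
open import Data.List.Relation.Unary.All using (All; []; _∷_)
open import Data.Bool using (true; false)
open import Data.Product using (∃; _×_; _,_)
open import Data.Sum using (inj₁; inj₂)
open import Data.Empty using (⊥; ⊥-elim)
open import Relation.Nullary using (Dec; yes; no; ¬_; _because_; ¬?)
open import Relation.Nullary.Decidable using (_×-dec_)
open import Relation.Unary using (Decidable)
open import Relation.Binary using (tri<; tri≈; tri>)
open import Relation.Binary.PropositionalEquality
open import Function using (_∘_; _⇔_; mk⇔; Equivalence)

ι : ∀ {p} {P : Set p} → Dec P → ℕ
ι (true  because _) = 1
ι (false because _) = 0

ι-yes : ∀ {p} {P : Set p} (d : Dec P) → P → ι d ≡ 1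
ι-yes (yes _)  _ = refl
ι-yes (no ¬p)  p = ⊥-elim (¬p p)

ι-no : ∀ {p} {P : Set p} (d : Dec P) → ¬ P → ι d ≡ 0
ι-no (yes p) ¬p = ⊥-elim (¬p p)
ι-no (no _)  _  = refl

ι-cong : ∀ {p q} {P : Set p} {Q : Set q} (d : Dec P) (e : Dec Q) →
         (P → Q) → (Q → P) → ι d ≡ ι e
ι-cong (yes p) e to _    = sym (ι-yes e (to p))
ι-cong (no ¬p) e _  from = sym (ι-no e (¬p ∘ from))

ι-× : ∀ {p q} {P : Set p} {Q : Set q} (d : Dec P) (e : Dec Q) → ι (d ×-dec e) ≡ ι d * ι e
ι-× (yes _) (yes _) = refl
ι-× (yes _) (no _)  = refl
ι-× (no _)  _       = refl

ι-¬ : ∀ {p} {P : Set p} (d : Dec P) → ι (¬? d) + ι d ≡ 1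
ι-¬ (yes _) = refl
ι-¬ (no _)  = refl

Σ< : ℕ → (ℕ → ℕ) → ℕ
Σ< zero    f = 0
Σ< (suc n) f = Σ< n f + f n

Σ<-cong : ∀ n {f g : ℕ → ℕ} → (∀ k → k < n → f k ≡ g k) → Σ< n f ≡ Σ< n g
Σ<-cong zero    _  = refl
Σ<-cong (suc n) eq = cong₂ _+_ (Σ<-cong n (λ k k<n → eq k (m<n⇒m<1+n k<n))) (eq n ≤-refl)

Σ<-cong′ : ∀ n {f g : ℕ → ℕ} → (∀ k → f k ≡ g k) → Σ< n f ≡ Σ< n g
Σ<-cong′ n eq = Σ<-cong n (λ k _ → eq k)

Σ<-zero : ∀ n → Σ< n (λ _ → 0) ≡ 0
Σ<-zero zero    = refl
Σ<-zero (suc n) = cong (_+ 0) (Σ<-zero n)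

Σ<-one : ∀ n → Σ< n (λ _ → 1) ≡ n
Σ<-one zero    = refl
Σ<-one (suc n) = trans (cong (_+ 1) (Σ<-one n)) (+-comm n 1)

Σ<-suc : ∀ n (f : ℕ → ℕ) → Σ< (suc n) f ≡ f 0 + Σ< n (f ∘ suc)
Σ<-suc zero    f = +-comm 0 (f 0)
Σ<-suc (suc n) f = trans (cong (_+ f (suc n)) (Σ<-suc n f)) (+-assoc (f 0) _ _)

-- A sum over one full period may start at 1 instead of 0.
Σ<-rotate : ∀ n (f : ℕ → ℕ) → f 0 ≡ f n → Σ< n (f ∘ suc) ≡ Σ< n f
Σ<-rotate n f f0≡fn = +-cancelˡ-≡ (f 0) _ _ (begin
  f 0 + Σ< n (f ∘ suc) ≡⟨ Σ<-suc n f ⟨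
  Σ< n f + f n         ≡⟨ cong (Σ< n f +_) f0≡fn ⟨
  Σ< n f + f 0         ≡⟨ +-comm (Σ< n f) (f 0) ⟩
  f 0 + Σ< n f         ∎)
  where open ≡-Reasoning

Σ<-+ : ∀ m n (f : ℕ → ℕ) → Σ< (m + n) f ≡ Σ< m f + Σ< n (λ k → f (m + k))
Σ<-+ m zero    f = trans (cong (λ z → Σ< z f) (+-identityʳ m)) (sym (+-identityʳ (Σ< m f)))
Σ<-+ m (suc n) f = begin
  Σ< (m + suc n) f                            ≡⟨ cong (λ z → Σ< z f) (+-suc m n) ⟩
  Σ< (m + n) f + f (m + n)                    ≡⟨ cong (_+ f (m + n)) (Σ<-+ m n f) ⟩
  Σ< m f + Σ< n (λ k → f (m + k)) + f (m + n) ≡⟨ +-assoc (Σ< m f) _ _ ⟩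
  Σ< m f + Σ< (suc n) (λ k → f (m + k))       ∎
  where open ≡-Reasoning

Σ<-distrib : ∀ n (f g : ℕ → ℕ) → Σ< n (λ k → f k + g k) ≡ Σ< n f + Σ< n g
Σ<-distrib zero    f g = refl
Σ<-distrib (suc n) f g = begin
  Σ< n (λ k → f k + g k) + (f n + g n) ≡⟨ cong (_+ (f n + g n)) (Σ<-distrib n f g) ⟩
  Σ< n f + Σ< n g + (f n + g n)       ≡⟨ +-interchange (Σ< n f) (Σ< n g) (f n) (g n) ⟩
  Σ< n f + f n + (Σ< n g + g n)       ∎
  where
  open ≡-Reasoning
  +-interchange : ∀ a b c d → a + b + (c + d) ≡ a + c + (b + d)
  +-interchange = solve-∀

Σ<-*ˡ : ∀ n c (f : ℕ → ℕ) → Σ< n (λ k → c * f k) ≡ c * Σ< n f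
Σ<-*ˡ zero    c f = sym (*-zeroʳ c)
Σ<-*ˡ (suc n) c f = trans (cong (_+ c * f n) (Σ<-*ˡ n c f)) (sym (*-distribˡ-+ c (Σ< n f) (f n)))

Σ<-*ʳ : ∀ n c (f : ℕ → ℕ) → Σ< n (λ k → f k * c) ≡ Σ< n f * c
Σ<-*ʳ n c f = begin
  Σ< n (λ k → f k * c) ≡⟨ Σ<-cong′ n (λ k → *-comm (f k) c) ⟩
  Σ< n (λ k → c * f k) ≡⟨ Σ<-*ˡ n c f ⟩
  c * Σ< n f           ≡⟨ *-comm c (Σ< n f) ⟩
  Σ< n f * c           ∎
  where open ≡-Reasoning

Σ<-swap : ∀ m n (f : ℕ → ℕ → ℕ) →
          Σ< m (λ i → Σ< n (λ j → f i j)) ≡ Σ< n (λ j → Σ< m (λ i → f i j))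
Σ<-swap zero    n f = sym (Σ<-zero n)
Σ<-swap (suc m) n f = begin
  Σ< m (λ i → Σ< n (f i)) + Σ< n (f m)        ≡⟨ cong (_+ Σ< n (f m)) (Σ<-swap m n f) ⟩
  Σ< n (λ j → Σ< m (λ i → f i j)) + Σ< n (f m) ≡⟨ Σ<-distrib n _ (f m) ⟨
  Σ< n (λ j → Σ< (suc m) (λ i → f i j))       ∎
  where open ≡-Reasoning

Σ<-block : ∀ b a (f : ℕ → ℕ) → Σ< (b * a) f ≡ Σ< b (λ t → Σ< a (λ r → f (t * a + r)))
Σ<-block zero    a f = refl
Σ<-block (suc b) a f = begin
  Σ< (a + b * a) f                ≡⟨ cong (λ z → Σ< z f) (+-comm a (b * a)) ⟩
  Σ< (b * a + a) f                ≡⟨ Σ<-+ (b * a) a f ⟩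
  Σ< (b * a) f + last-block       ≡⟨ cong (_+ last-block) (Σ<-block b a f) ⟩
  Σ< b (λ t → Σ< a (λ r → f (t * a + r))) + last-block ∎
  where
  open ≡-Reasoning
  last-block = Σ< a (λ r → f (b * a + r))

Σ<-point : ∀ n t₀ → t₀ < n → Σ< n (λ t → ι (t ≟ t₀)) ≡ 1
Σ<-point (suc n) t₀ t₀<1+n with t₀ ≟ n
... | yes refl = cong₂ _+_ before (ι-yes (n ≟ n) refl)
  where
  before : Σ< n (λ t → ι (t ≟ n)) ≡ 0
  before = trans (Σ<-cong n (λ k k<n → ι-no (k ≟ n) (<⇒≢ k<n))) (Σ<-zero n)
... | no t₀≢n = cong₂ _+_ (Σ<-point n t₀ (≤∧≢⇒< (≤-pred t₀<1+n) t₀≢n))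
                          (ι-no (n ≟ t₀) (t₀≢n ∘ sym))

Σ<-unique : ∀ {q} {Q : ℕ → Set q} (Q? : Decidable Q) n t₀ → t₀ < n → Q t₀ →
            (∀ t → t < n → Q t → t ≡ t₀) → Σ< n (λ t → ι (Q? t)) ≡ 1
Σ<-unique Q? n t₀ t₀<n Qt₀ unique = trans
  (Σ<-cong n (λ t t<n → ι-cong (Q? t) (t ≟ t₀) (unique t t<n) (λ { refl → Qt₀ })))
  (Σ<-point n t₀ t₀<n)

Σ<-complement : ∀ {q} {Q : ℕ → Set q} (Q? : Decidable Q) n →
                Σ< n (λ t → ι (¬? (Q? t))) + Σ< n (λ t → ι (Q? t)) ≡ n
Σ<-complement Q? n = trans (sym (Σ<-distrib n _ _))
                           (trans (Σ<-cong′ n (λ t → ι-¬ (Q? t))) (Σ<-one n))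

sum-filter : ∀ n (g f : ℕ → ℕ) {p} {P : ℕ → Set p} (P? : Decidable P) →
  sum (map f (filter P? (applyUpTo g n))) ≡ Σ< n (λ k → ι (P? (g k)) * f (g k))
sum-filter zero    g f P? = refl
sum-filter (suc n) g f P? =
  trans head-and-tail (sym (Σ<-suc n (λ k → ι (P? (g k)) * f (g k))))
  where
  tail-sum : sum (map f (filter P? (applyUpTo (g ∘ suc) n))) ≡
             Σ< n (λ k → ι (P? (g (suc k))) * f (g (suc k)))
  tail-sum = sum-filter n (g ∘ suc) f P?
  head-and-tail : sum (map f (filter P? (g 0 ∷ applyUpTo (g ∘ suc) n))) ≡
                  ι (P? (g 0)) * f (g 0) + Σ< n (λ k → ι (P? (g (suc k))) * f (g (suc k)))
  head-and-tail with P? (g 0)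
  ... | yes _ = cong₂ _+_ (sym (+-identityʳ (f (g 0)))) tail-sum
  ... | no _  = tail-sum

length≡sum-ones : (xs : List ℕ) → length xs ≡ sum (map (λ _ → 1) xs)
length≡sum-ones []       = refl
length≡sum-ones (_ ∷ xs) = cong suc (length≡sum-ones xs)

χ : ℕ → ℕ → ℕ
χ N k = ι (gcd k N ≟ 1)

χ-period : ∀ N → χ N 0 ≡ χ N N
χ-period N = cong (λ g → ι (g ≟ 1)) (trans (gcd-identityˡ N) (sym gcd[N,N]≡N))
  where
  gcd[N,N]≡N : gcd N N ≡ N
  gcd[N,N]≡N = ∣-antisym (gcd[m,n]∣m N N) (gcd-greatest ∣-refl ∣-refl)

reducedSum : ℕ → (ℕ → ℕ) → ℕ
reducedSum N f = Σ< N (λ k → χ N k * f k)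

φ-as-reducedSum : ∀ n → φ n ≡ reducedSum n (λ _ → 1)
φ-as-reducedSum n = begin
  φ n                                   ≡⟨ cong (length ∘ filter coprime?) (map-upTo suc n) ⟩
  length (filter coprime? units)        ≡⟨ length≡sum-ones (filter coprime? units) ⟩
  sum (map (λ _ → 1) (filter coprime? units)) ≡⟨ sum-filter n suc (λ _ → 1) coprime? ⟩
  Σ< n (λ k → χ n (suc k) * 1)          ≡⟨ Σ<-rotate n (λ k → χ n k * 1) (cong (_* 1) (χ-period n)) ⟩
  reducedSum n (λ _ → 1)                ∎
  where
  open ≡-Reasoning
  units : List ℕ
  units = applyUpTo suc n
  coprime? : Decidable (λ k → gcd k n ≡ 1)
  coprime? k = gcd k n ≟ 1

Σ∣ : ℕ → (ℕ → ℕ) → ℕ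
Σ∣ m f = Σ< m (λ j → ι (suc j ∣? m) * f (suc j))

sumDivisors-as-Σ∣ : ∀ m f → sumDivisors m f ≡ Σ∣ m f
sumDivisors-as-Σ∣ m f = trans (cong (λ ds → sum (map f (filter (_∣? m) ds))) (map-upTo suc m))
                              (sum-filter m suc f (_∣? m))

Σ∣-cong : ∀ m {f g : ℕ → ℕ} → (∀ d → d ∣ m → .{{NonZero d}} → f d ≡ g d) →
          Σ∣ m f ≡ Σ∣ m g
Σ∣-cong m {f} {g} eq = Σ<-cong′ m (λ j → on-divisors j (suc j ∣? m))
  where
  on-divisors : ∀ j (d : Dec (suc j ∣ m)) → ι d * f (suc j) ≡ ι d * g (suc j)
  on-divisors j (yes j+1∣m) = cong (1 *_) (eq (suc j) j+1∣m)
  on-divisors j (no _)      = refl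

Σ∣-*ˡ : ∀ m c (f : ℕ → ℕ) → c * Σ∣ m f ≡ Σ∣ m (λ d → c * f d)
Σ∣-*ˡ m c f = trans (sym (Σ<-*ˡ m c _))
                    (Σ<-cong′ m (λ j → *-CS.x∙yz≈y∙xz c (ι (suc j ∣? m)) (f (suc j))))

Σ<-Σ∣-swap : ∀ n m (f : ℕ → ℕ → ℕ) →
             Σ< n (λ k → Σ∣ m (f k)) ≡ Σ∣ m (λ d → Σ< n (λ k → f k d))
Σ<-Σ∣-swap n m f = trans (Σ<-swap n m _)
                         (Σ<-cong′ m (λ j → Σ<-*ˡ n (ι (suc j ∣? m)) (λ k → f k (suc j))))

Σ∣-product : ∀ m m′ (f g : ℕ → ℕ) →
             Σ∣ m f * Σ∣ m′ g ≡ Σ∣ m (λ d → Σ∣ m′ (λ d′ → f d * g d′))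
Σ∣-product m m′ f g = begin
  Σ∣ m f * Σ∣ m′ g                        ≡⟨ *-comm (Σ∣ m f) (Σ∣ m′ g) ⟩
  Σ∣ m′ g * Σ∣ m f                        ≡⟨ Σ∣-*ˡ m (Σ∣ m′ g) f ⟩
  Σ∣ m (λ d → Σ∣ m′ g * f d)              ≡⟨ Σ∣-cong m (λ d _ → distribute d) ⟩
  Σ∣ m (λ d → Σ∣ m′ (λ d′ → f d * g d′))  ∎
  where
  open ≡-Reasoning
  distribute : ∀ d → Σ∣ m′ g * f d ≡ Σ∣ m′ (λ d′ → f d * g d′)
  distribute d = trans (*-comm (Σ∣ m′ g) (f d)) (Σ∣-*ˡ m′ (f d) g)

gcd≢0ˡ : ∀ m n → .{{NonZero m}} → NonZero (gcd m n)
gcd≢0ˡ m n = ≢-nonZero (gcd[m,n]≢0 m n (inj₁ (≢-nonZero⁻¹ m)))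

gcd≢0ʳ : ∀ m n → .{{NonZero n}} → NonZero (gcd m n)
gcd≢0ʳ m n = ≢-nonZero (gcd[m,n]≢0 m n (inj₂ (≢-nonZero⁻¹ n)))

gcd-cong : ∀ x y m → (∀ c → c ∣ m → (c ∣ x ⇔ c ∣ y)) → gcd x m ≡ gcd y m
gcd-cong x y m same-divisors =
  ∣-antisym (common-divisor x y (λ c c∣m → Equivalence.to (same-divisors c c∣m)))
            (common-divisor y x (λ c c∣m → Equivalence.from (same-divisors c c∣m)))
  where
  common-divisor : ∀ x y → (∀ c → c ∣ m → c ∣ x → c ∣ y) → gcd x m ∣ gcd y m
  common-divisor x y x⇒y = gcd-greatest (x⇒y _ (gcd[m,n]∣n x m) (gcd[m,n]∣m x m)) (gcd[m,n]∣n x m)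

coprime-∣ʳ : ∀ {x n d} → d ∣ n → Coprime x n → Coprime x d
coprime-∣ʳ d∣n coprime (c∣x , c∣d) = coprime (c∣x , ∣-trans c∣d d∣n)

coprime-*ʳ : ∀ {x a b} → Coprime x a → Coprime x b → Coprime x (a * b)
coprime-*ʳ {x} {a} coprime-a coprime-b {c} (c∣x , c∣ab) =
  coprime-b (c∣x , coprime-divisor c⊥a c∣ab)
  where
  c⊥a : Coprime c a
  c⊥a (e∣c , e∣a) = coprime-a (∣-trans e∣c c∣x , e∣a)

coprime-shift : ∀ t {N r} → Coprime (t * N + r) N ⇔ Coprime r N
coprime-shift t = mk⇔
  (λ coprime {_} (c∣r , c∣N) → coprime (∣m∣n⇒∣m+n (∣n⇒∣m*n t c∣N) c∣r , c∣N))
  (λ coprime {_} (c∣tN+r , c∣N) → coprime (∣m+n∣m⇒∣n c∣tN+r (∣n⇒∣m*n t c∣N) , c∣N))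

prime-coprime : ∀ {p x} → Prime p → ¬ p ∣ x → Coprime p x
prime-coprime pp p∤x {c} (c∣p , c∣x) with prime⇒irreducible pp c∣p
... | inj₁ c≡1 = c≡1
... | inj₂ refl = ⊥-elim (p∤x c∣x)

prime-not-coprime : ∀ {p x} → Prime p → p ∣ x → ¬ Coprime x p
prime-not-coprime {suc (suc _)} pp p∣x coprime with () ← coprime (p∣x , ∣-refl)

coprime-lcm : ∀ k d₁ d₂ → Coprime k (lcm d₁ d₂) ⇔ (Coprime k d₁ × Coprime k d₂)
coprime-lcm k d₁ d₂ = mk⇔ to from
  where
  to : Coprime k (lcm d₁ d₂) → Coprime k d₁ × Coprime k d₂
  to coprime = coprime-∣ʳ (m∣lcm[m,n] d₁ d₂) coprime , coprime-∣ʳ (n∣lcm[m,n] d₁ d₂) coprime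
  from : Coprime k d₁ × Coprime k d₂ → Coprime k (lcm d₁ d₂)
  from (coprime₁ , coprime₂) =
    coprime-∣ʳ (lcm-least {d₁} {d₂} (m∣m*n d₂) (n∣m*n d₁)) (coprime-*ʳ coprime₁ coprime₂)

χ-lift : ∀ p N t r → Prime p → χ (p * N) (t * N + r) ≡ χ N r * ι (¬? (p ∣? t * N + r))
χ-lift p N t r pp = trans
  (ι-cong (gcd (t * N + r) (p * N) ≟ 1) ((gcd r N ≟ 1) ×-dec ¬? (p ∣? t * N + r)) to from)
  (ι-× (gcd r N ≟ 1) (¬? (p ∣? t * N + r)))
  where
  to : gcd (t * N + r) (p * N) ≡ 1 → gcd r N ≡ 1 × ¬ p ∣ t * N + r
  to eq = coprime⇒gcd≡1 (Equivalence.to (coprime-shift t) (coprime-∣ʳ (n∣m*n p) coprime))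
        , λ p∣ → prime-not-coprime pp p∣ (coprime-∣ʳ (m∣m*n N) coprime)
    where coprime = gcd≡1⇒coprime eq
  from : gcd r N ≡ 1 × ¬ p ∣ t * N + r → gcd (t * N + r) (p * N) ≡ 1
  from (eq , p∤) = coprime⇒gcd≡1 (coprime-*ʳ (Coprime.sym (prime-coprime pp p∤))
                                             (Equivalence.from (coprime-shift t) (gcd≡1⇒coprime eq)))

-- When p ∤ N, some lift tN + r is divisible by p (N is invertible mod p).
divisible-lift-exists : ∀ p N r → Prime p → Coprime p N → ∃ λ t → p ∣ t * N + r
divisible-lift-exists p@(suc q) N r _ coprime with coprime-Bézout coprime
... | Bézout.+- x y eq = y * r , divides (r * x) (begin
  y * r * N + r  ≡⟨ factor-r y r N ⟩
  r * (1 + y * N) ≡⟨ cong (r *_) eq ⟩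
  r * (x * p)    ≡⟨ *-assoc r x p ⟨
  r * x * p      ∎)
  where
  open ≡-Reasoning
  factor-r : ∀ y r N → y * r * N + r ≡ r * (1 + y * N)
  factor-r = solve-∀
... | Bézout.-+ x y eq = q * y * r , divides (r + q * r * x) (begin
  q * y * r * N + r          ≡⟨ regroup q y r N ⟩
  q * r * (y * N) + r        ≡⟨ cong (λ z → q * r * z + r) eq ⟨
  q * r * (1 + x * p) + r    ≡⟨ factor-p q r x ⟩
  (r + q * r * x) * p        ∎)
  where
  open ≡-Reasoning
  regroup : ∀ q y r N → q * y * r * N + r ≡ q * r * (y * N) + r
  regroup = solve-∀
  factor-p : ∀ q r x → q * r * (1 + x * suc q) + r ≡ (r + q * r * x) * suc q
  factor-p = solve-∀

divisible-lift-mod : ∀ p N r t .{{_ : NonZero p}} → p ∣ t * N + r → p ∣ t % p * N + r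
divisible-lift-mod p N r t p∣ = ∣m+n∣m⇒∣n (subst (p ∣_) split p∣) (∣m⇒∣m*n N (n∣m*n (t / p)))
  where
  open ≡-Reasoning
  regroup : ∀ a b N r → (a + b) * N + r ≡ b * N + (a * N + r)
  regroup = solve-∀
  split : t * N + r ≡ t / p * p * N + (t % p * N + r)
  split = begin
    t * N + r                     ≡⟨ cong (λ z → z * N + r) (m≡m%n+[m/n]*n t p) ⟩
    (t % p + t / p * p) * N + r   ≡⟨ regroup (t % p) (t / p * p) N r ⟩
    t / p * p * N + (t % p * N + r) ∎

-- When p ∤ N, two lifts a < b < p cannot both be divisible by p: otherwise
-- p ∣ (b − a)N, so p ∣ b − a, which is impossible for 0 < b − a < p.
no-two-divisible-lifts : ∀ {p N r a b} → Coprime p N → a < b → b < p →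
                         p ∣ a * N + r → p ∣ b * N + r → ⊥
no-two-divisible-lifts {p} {N} {r} {a} {b} coprime a<b b<p p∣a p∣b =
  <⇒≱ (≤-<-trans (m∸n≤m b a) b<p) (∣⇒≤ {{>-nonZero (m<n⇒0<n∸m a<b)}} p∣b-a)
  where
  open ≡-Reasoning
  regroup : ∀ a d N r → (a + d) * N + r ≡ (a * N + r) + d * N
  regroup = solve-∀
  b-as-a+d : b * N + r ≡ (a * N + r) + (b ∸ a) * N
  b-as-a+d = begin
    b * N + r                 ≡⟨ cong (λ z → z * N + r) (m+[n∸m]≡n (<⇒≤ a<b)) ⟨
    (a + (b ∸ a)) * N + r     ≡⟨ regroup a (b ∸ a) N r ⟩
    (a * N + r) + (b ∸ a) * N ∎
  p∣b-a : p ∣ b ∸ a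
  p∣b-a = coprime-divisor coprime
    (subst (p ∣_) (*-comm (b ∸ a) N) (∣m+n∣m⇒∣n (subst (p ∣_) b-as-a+d p∣b) p∣a))

divisible-lift-unique : ∀ {p N r t₁ t₂} → Coprime p N → t₁ < p → t₂ < p →
                        p ∣ t₁ * N + r → p ∣ t₂ * N + r → t₁ ≡ t₂
divisible-lift-unique {t₁ = t₁} {t₂} coprime t₁<p t₂<p p∣₁ p∣₂ with <-cmp t₁ t₂
... | tri< t₁<t₂ _ _ = ⊥-elim (no-two-divisible-lifts coprime t₁<t₂ t₂<p p∣₁ p∣₂)
... | tri≈ _ t₁≡t₂ _ = t₁≡t₂
... | tri> _ _ t₂<t₁ = ⊥-elim (no-two-divisible-lifts coprime t₂<t₁ t₁<p p∣₂ p∣₁)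

-- r_p(N) = φ(pN)/φ(N) for a prime p: p if p ∣ N, and p − 1 otherwise.
φ-ratio : ℕ → ℕ → ℕ
φ-ratio N p = p ∸ 1 + ι (p ∣? N)

-- For r prime to N, exactly r_p(N) of the lifts tN + r (t < p) are prime to p:
-- all of them if p ∣ N, and all but the unique divisible one if p ∤ N.
lifts-prime-to-p : ∀ p N r → Prime p → Coprime r N →
                   Σ< p (λ t → ι (¬? (p ∣? t * N + r))) ≡ φ-ratio N p
lifts-prime-to-p p@(suc _) N r pp r⊥N with p ∣? N
... | yes p∣N = begin
  Σ< p (λ t → ι (¬? (p ∣? t * N + r))) ≡⟨ Σ<-cong′ p (λ t → ι-yes (¬? (p ∣? _)) (p∤lift t)) ⟩
  Σ< p (λ _ → 1)                       ≡⟨ Σ<-one p ⟩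
  p                                    ≡⟨ m∸n+n≡m {p} {1} (s≤s z≤n) ⟨
  p ∸ 1 + 1                            ∎
  where
  open ≡-Reasoning
  p∤lift : ∀ t → ¬ p ∣ t * N + r
  p∤lift t p∣ = prime-not-coprime pp (∣m+n∣m⇒∣n p∣ (∣n⇒∣m*n t p∣N)) (coprime-∣ʳ p∣N r⊥N)
... | no p∤N = begin
  free                               ≡⟨ m+n∸n≡m free 1 ⟨
  free + 1 ∸ 1                       ≡⟨ cong (λ z → free + z ∸ 1) one-divisible ⟨
  free + Σ< p (λ t → ι (divides? t)) ∸ 1 ≡⟨ cong (_∸ 1) (Σ<-complement divides? p) ⟩
  p ∸ 1                              ≡⟨ +-identityʳ (p ∸ 1) ⟨
  p ∸ 1 + 0                          ∎
  where
  open ≡-Reasoning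
  divides? : Decidable (λ t → p ∣ t * N + r)
  divides? t = p ∣? t * N + r
  free : ℕ
  free = Σ< p (λ t → ι (¬? (divides? t)))
  p⊥N : Coprime p N
  p⊥N = prime-coprime pp p∤N
  one-divisible : Σ< p (λ t → ι (divides? t)) ≡ 1
  one-divisible with (t , p∣) ← divisible-lift-exists p N r pp p⊥N =
    Σ<-unique divides? p (t % p) (m%n<n t p) p∣reduced
              (λ t′ t′<p p∣′ → divisible-lift-unique p⊥N t′<p (m%n<n t p) p∣′ p∣reduced)
    where
    p∣reduced : p ∣ t % p * N + r
    p∣reduced = divisible-lift-mod p N r t p∣

Periodic : ℕ → (ℕ → ℕ) → Set
Periodic N f = ∀ t r → f (t * N + r) ≡ f r

Periodic-∣ : ∀ {L M} {f : ℕ → ℕ} → L ∣ M → Periodic L f → Periodic M f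
Periodic-∣ {L} {f = f} (divides q refl) periodic t r =
  trans (cong (λ z → f (z + r)) (sym (*-assoc t q L))) (periodic (t * q) r)

Periodic-* : ∀ {N} {f g : ℕ → ℕ} → Periodic N f → Periodic N g → Periodic N (λ k → f k * g k)
Periodic-* f-periodic g-periodic t r = cong₂ _*_ (f-periodic t r) (g-periodic t r)

Periodic-at-period : ∀ {N} {f : ℕ → ℕ} → Periodic N f → f N ≡ f 0
Periodic-at-period {N} {f} periodic = trans (cong f N≡1*N+0) (periodic 1 0)
  where
  N≡1*N+0 : N ≡ 1 * N + 0
  N≡1*N+0 = sym (trans (+-identityʳ (1 * N)) (*-identityˡ N))

reducedSum-prime-step : ∀ p N (f : ℕ → ℕ) → Prime p → Periodic N f →
                        reducedSum (p * N) f ≡ φ-ratio N p * reducedSum N f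
reducedSum-prime-step p N f pp periodic = begin
  reducedSum (p * N) f
    ≡⟨ Σ<-block p N _ ⟩
  Σ< p (λ t → Σ< N (λ r → χ′ t r * f (t * N + r)))
    ≡⟨ Σ<-cong′ p (λ t → Σ<-cong′ N (λ r → cong (χ′ t r *_) (periodic t r))) ⟩
  Σ< p (λ t → Σ< N (λ r → χ′ t r * f r))
    ≡⟨ Σ<-swap p N _ ⟩
  Σ< N (λ r → Σ< p (λ t → χ′ t r * f r))
    ≡⟨ Σ<-cong′ N (λ r → Σ<-*ʳ p (f r) (λ t → χ′ t r)) ⟩
  Σ< N (λ r → Σ< p (λ t → χ′ t r) * f r)
    ≡⟨ Σ<-cong′ N (λ r → cong (_* f r) (reduced-lifts r)) ⟩
  Σ< N (λ r → φ-ratio N p * χ N r * f r)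
    ≡⟨ Σ<-cong′ N (λ r → *-assoc (φ-ratio N p) (χ N r) (f r)) ⟩
  Σ< N (λ r → φ-ratio N p * (χ N r * f r))
    ≡⟨ Σ<-*ˡ N (φ-ratio N p) _ ⟩
  φ-ratio N p * reducedSum N f
    ∎
  where
  open ≡-Reasoning
  χ′ : ℕ → ℕ → ℕ
  χ′ t r = χ (p * N) (t * N + r)
  reduced-lifts : ∀ r → Σ< p (λ t → χ′ t r) ≡ φ-ratio N p * χ N r
  reduced-lifts r = begin
    Σ< p (λ t → χ′ t r)                            ≡⟨ Σ<-cong′ p (λ t → χ-lift p N t r pp) ⟩
    Σ< p (λ t → χ N r * ι (¬? (p ∣? t * N + r)))   ≡⟨ Σ<-*ˡ p (χ N r) _ ⟩
    χ N r * Σ< p (λ t → ι (¬? (p ∣? t * N + r)))   ≡⟨ by-cases (gcd r N ≟ 1) ⟩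
    φ-ratio N p * χ N r                            ∎
    where
    by-cases : (d : Dec (gcd r N ≡ 1)) →
               ι d * Σ< p (λ t → ι (¬? (p ∣? t * N + r))) ≡ φ-ratio N p * ι d
    by-cases (yes r⊥N) = trans (+-identityʳ _)
      (trans (lifts-prime-to-p p N r pp (gcd≡1⇒coprime r⊥N)) (sym (*-identityʳ _)))
    by-cases (no _)    = sym (*-zeroʳ (φ-ratio N p))

-- liftRatio N [p₁,…,pₖ] = φ(N p₁⋯pₖ)/φ(N), the product of the prime-step ratios.
liftRatio : ℕ → List ℕ → ℕ
liftRatio N []       = 1
liftRatio N (p ∷ ps) = φ-ratio (N * product ps) p * liftRatio N ps

reducedSum-lift : ∀ L (f : ℕ → ℕ) → Periodic L f → ∀ ps → All Prime ps →
                  reducedSum (L * product ps) f ≡ liftRatio L ps * reducedSum L f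
reducedSum-lift L f periodic []       []         = trans (cong (λ z → reducedSum z f) (*-identityʳ L))
                                                         (sym (*-identityˡ (reducedSum L f)))
reducedSum-lift L f periodic (p ∷ ps) (pp ∷ pps) = begin
  reducedSum (L * (p * Q)) f                ≡⟨ cong (λ z → reducedSum z f) (*-CS.x∙yz≈y∙xz L p Q) ⟩
  reducedSum (p * (L * Q)) f                ≡⟨ reducedSum-prime-step p (L * Q) f pp
                                                 (Periodic-∣ (m∣m*n Q) periodic) ⟩
  ratio * reducedSum (L * Q) f              ≡⟨ cong (ratio *_) (reducedSum-lift L f periodic ps pps) ⟩
  ratio * (liftRatio L ps * reducedSum L f) ≡⟨ *-assoc ratio (liftRatio L ps) _ ⟨
  liftRatio L (p ∷ ps) * reducedSum L f     ∎
  where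
  open ≡-Reasoning
  Q = product ps
  ratio = φ-ratio (L * Q) p

φ-lift : ∀ L ps → All Prime ps → φ (L * product ps) ≡ liftRatio L ps * φ L
φ-lift L ps pps = begin
  φ (L * product ps)                          ≡⟨ φ-as-reducedSum (L * product ps) ⟩
  reducedSum (L * product ps) (λ _ → 1)       ≡⟨ reducedSum-lift L (λ _ → 1) (λ _ _ → refl) ps pps ⟩
  liftRatio L ps * reducedSum L (λ _ → 1)     ≡⟨ cong (liftRatio L ps *_) (φ-as-reducedSum L) ⟨
  liftRatio L ps * φ L                        ∎
  where open ≡-Reasoning

-- The ratio only sees which primes of the list divide the base: it is the same for
-- B ∣ A when every prime of the list dividing A already divides B.
liftRatio-cong : ∀ A B → B ∣ A → ∀ ps → All Prime ps →
                 (∀ p → p ∣ product ps → p ∣ A → p ∣ B) → liftRatio A ps ≡ liftRatio B ps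
liftRatio-cong A B B∣A []       []         _     = refl
liftRatio-cong A B B∣A (p ∷ ps) (pp ∷ pps) A⇒B =
  cong₂ _*_ (cong ((p ∸ 1) +_) (ι-cong (p ∣? A * Q) (p ∣? B * Q) to from))
            (liftRatio-cong A B B∣A ps pps (λ q q∣Q → A⇒B q (∣n⇒∣m*n p q∣Q)))
  where
  Q = product ps
  to : p ∣ A * Q → p ∣ B * Q
  to p∣AQ with euclidsLemma A Q pp p∣AQ
  ... | inj₁ p∣A = ∣m⇒∣m*n Q (A⇒B p (m∣m*n Q) p∣A)
  ... | inj₂ p∣Q = ∣n⇒∣m*n B p∣Q
  from : p ∣ B * Q → p ∣ A * Q
  from p∣BQ = ∣-trans p∣BQ (*-monoˡ-∣ Q B∣A)

multiple-as-lift : ∀ {L M} → L ∣ M → .{{NonZero M}} →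
                   ∃ λ ps → All Prime ps × M ≡ L * product ps
multiple-as-lift {L} L∣M@(divides q M≡qL) =
  factors , factorsPrime , trans M≡qL (trans (*-comm q L) (cong (L *_) isFactorisation))
  where
  instance _ = quotient≢0 L∣M
  open PrimeFactorisation (factorise q)

reducedSum-multiple : ∀ L M (f : ℕ → ℕ) → Periodic L f → L ∣ M → .{{NonZero M}} →
                      reducedSum M f * φ L ≡ φ M * reducedSum L f
reducedSum-multiple L M f periodic L∣M with multiple-as-lift L∣M
... | ps , pps , refl = begin
  reducedSum (L * product ps) f * φ L      ≡⟨ cong (_* φ L) (reducedSum-lift L f periodic ps pps) ⟩
  liftRatio L ps * reducedSum L f * φ L    ≡⟨ *-CS.xy∙z≈xz∙y (liftRatio L ps) (reducedSum L f) (φ L) ⟩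
  liftRatio L ps * φ L * reducedSum L f    ≡⟨ cong (_* reducedSum L f) (φ-lift L ps pps) ⟨
  φ (L * product ps) * reducedSum L f      ∎
  where open ≡-Reasoning

-- With g = gcd(d₁,d₂) and d₂ = g·Q, one
-- has lcm[d₁,d₂] = d₁·Q, and lifting d₁ and g by Q multiplies φ by the same ratio
-- because every prime of Q dividing d₁ divides g.
φ-lcm-gcd : ∀ d₁ d₂ → .{{NonZero d₁}} → .{{NonZero d₂}} →
            φ (lcm d₁ d₂) * φ (gcd d₁ d₂) ≡ φ d₁ * φ d₂
φ-lcm-gcd d₁ d₂ with multiple-as-lift (gcd[m,n]∣n d₁ d₂)
... | ps , pps , d₂≡gQ = begin
  φ (lcm d₁ d₂) * φ g                   ≡⟨ cong (λ l → φ l * φ g) lcm≡d₁Q ⟩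
  φ (d₁ * Q) * φ g                      ≡⟨ cong (_* φ g) (φ-lift d₁ ps pps) ⟩
  liftRatio d₁ ps * φ d₁ * φ g          ≡⟨ cong (λ r → r * φ d₁ * φ g) same-ratio ⟩
  liftRatio g ps * φ d₁ * φ g           ≡⟨ *-CS.xy∙z≈y∙xz (liftRatio g ps) (φ d₁) (φ g) ⟩
  φ d₁ * (liftRatio g ps * φ g)         ≡⟨ cong (φ d₁ *_) (φ-lift g ps pps) ⟨
  φ d₁ * φ (g * Q)                      ≡⟨ cong (λ n → φ d₁ * φ n) d₂≡gQ ⟨
  φ d₁ * φ d₂                           ∎
  where
  open ≡-Reasoning
  g = gcd d₁ d₂
  Q = product ps
  instance _ = gcd≢0ˡ d₁ d₂
  lcm≡d₁Q : lcm d₁ d₂ ≡ d₁ * Q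
  lcm≡d₁Q = *-cancelˡ-≡ (lcm d₁ d₂) (d₁ * Q) g (begin
    g * lcm d₁ d₂  ≡⟨ gcd*lcm d₁ d₂ ⟩
    d₁ * d₂        ≡⟨ cong (d₁ *_) d₂≡gQ ⟩
    d₁ * (g * Q)   ≡⟨ *-CS.x∙yz≈y∙xz d₁ g Q ⟩
    g * (d₁ * Q)   ∎)
  same-ratio : liftRatio d₁ ps ≡ liftRatio g ps
  same-ratio = liftRatio-cong d₁ g (gcd[m,n]∣m d₁ d₂) ps pps
    (λ p p∣Q p∣d₁ → gcd-greatest p∣d₁ (∣-trans p∣Q (subst (Q ∣_) (sym d₂≡gQ) (n∣m*n g))))

divisor-pair-term : ∀ d₁ d₂ M (f : ℕ → ℕ) →
                    .{{NonZero d₁}} → .{{NonZero d₂}} → .{{NonZero M}} →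
                    lcm d₁ d₂ ∣ M → Periodic (lcm d₁ d₂) f →
                    φ d₁ * φ d₂ * reducedSum M f ≡
                    φ M * (φ (gcd d₁ d₂) * reducedSum (lcm d₁ d₂) f)
divisor-pair-term d₁ d₂ M f L∣M periodic = begin
  φ d₁ * φ d₂ * reducedSum M f          ≡⟨ cong (_* reducedSum M f) (φ-lcm-gcd d₁ d₂) ⟨
  φ L * φ g * reducedSum M f            ≡⟨ *-CS.xy∙z≈y∙zx (φ L) (φ g) (reducedSum M f) ⟩
  φ g * (reducedSum M f * φ L)          ≡⟨ cong (φ g *_) (reducedSum-multiple L M f periodic L∣M) ⟩
  φ g * (φ M * reducedSum L f)          ≡⟨ *-CS.x∙yz≈y∙xz (φ g) (φ M) (reducedSum L f) ⟩
  φ M * (φ g * reducedSum L f)          ∎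
  where
  open ≡-Reasoning
  L = lcm d₁ d₂
  g = gcd d₁ d₂

-- Gauss' identity Σ_{d∣n} φ(d) = n, by sorting the residues k < n according to the
-- cofactor n / gcd(k,n).

hasCofactor : ℕ → ℕ → ℕ → ℕ
hasCofactor n k d = ι (gcd k n * d ≟ n)

cofactor-unique : ∀ n k → .{{NonZero n}} → Σ< n (λ j → hasCofactor n k (suc j)) ≡ 1
cofactor-unique n k with gcd[m,n]∣n k n
... | g∣n@(divides q n≡qg) = Σ<-unique (λ j → g * suc j ≟ n) n (pred q) q-1<n g*[1+q-1]≡n unique
  where
  g = gcd k n
  instance
    _ = quotient≢0 g∣n
    _ = gcd≢0ʳ k n
  g*[1+q-1]≡n : g * suc (pred q) ≡ n
  g*[1+q-1]≡n = trans (cong (g *_) (suc-pred q)) (trans (*-comm g q) (sym n≡qg))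
  q-1<n : pred q < n
  q-1<n = subst (_≤ n) (sym (suc-pred q)) (subst (q ≤_) (sym n≡qg) (m≤m*n q g))
  unique : ∀ j → j < n → g * suc j ≡ n → j ≡ pred q
  unique j _ g*[1+j]≡n =
    suc-injective (*-cancelˡ-≡ (suc j) (suc (pred q)) g (trans g*[1+j]≡n (sym g*[1+q-1]≡n)))

-- Writing k < d·e as k = t·e + r: gcd(k, d·e)·d = d·e holds iff r = 0 and
-- gcd(t,d) = 1, so exactly φ(d) residues have cofactor d.
cofactor-class : ∀ d e → .{{NonZero d}} → .{{NonZero e}} →
                 Σ< (d * e) (λ k → hasCofactor (d * e) k d) ≡ φ d
cofactor-class d e@(suc e′) = begin
  Σ< (d * e) (λ k → hasCofactor (d * e) k d)                       ≡⟨ Σ<-block d e _ ⟩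
  Σ< d (λ t → Σ< e (λ r → cofactor t r))                           ≡⟨ Σ<-cong′ d (λ t → Σ<-suc e′ _) ⟩
  Σ< d (λ t → cofactor t 0 + Σ< e′ (λ r → cofactor t (suc r)))     ≡⟨ Σ<-cong′ d (λ t → cong₂ _+_
                                                                        (aligned t) (misaligned-sum t)) ⟩
  Σ< d (λ t → χ d t * 1 + 0)                                       ≡⟨ Σ<-cong′ d (λ t → +-identityʳ _) ⟩
  reducedSum d (λ _ → 1)                                           ≡⟨ φ-as-reducedSum d ⟨
  φ d                                                              ∎
  where
  open ≡-Reasoning
  instance _ = m*n≢0 d e
  cofactor : ℕ → ℕ → ℕ
  cofactor t r = hasCofactor (d * e) (t * e + r) d
  gcd-scaled : ∀ t → gcd (t * e + 0) (d * e) * d ≡ (d * e) * gcd t d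
  gcd-scaled t = begin
    gcd (t * e + 0) (d * e) * d ≡⟨ cong₂ (λ x y → gcd x y * d) (trans (+-identityʳ (t * e)) (*-comm t e))
                                                              (*-comm d e) ⟩
    gcd (e * t) (e * d) * d     ≡⟨ cong (_* d) (c*gcd[m,n]≡gcd[cm,cn] e t d) ⟨
    e * gcd t d * d             ≡⟨ *-CS.xy∙z≈zx∙y e (gcd t d) d ⟩
    d * e * gcd t d             ∎
  aligned : ∀ t → cofactor t 0 ≡ χ d t * 1
  aligned t = trans (ι-cong (gcd (t * e + 0) (d * e) * d ≟ d * e) (gcd t d ≟ 1) to from)
                    (sym (*-identityʳ _))
    where
    to : gcd (t * e + 0) (d * e) * d ≡ d * e → gcd t d ≡ 1
    to eq = *-cancelˡ-≡ (gcd t d) 1 (d * e)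
              (trans (sym (gcd-scaled t)) (trans eq (sym (*-identityʳ (d * e)))))
    from : gcd t d ≡ 1 → gcd (t * e + 0) (d * e) * d ≡ d * e
    from eq = trans (gcd-scaled t) (trans (cong ((d * e) *_) eq) (*-identityʳ (d * e)))
  -- Cofactor d forces gcd(k, d·e) = e, so e ∣ r with 0 < r < e: impossible.
  misaligned : ∀ t r → r < e′ → cofactor t (suc r) ≡ 0
  misaligned t r r<e′ = ι-no _ λ eq → <⇒≱ (s≤s r<e′) (∣⇒≤ (e∣1+r eq))
    where
    e∣1+r : gcd (t * e + suc r) (d * e) * d ≡ d * e → e ∣ suc r
    e∣1+r eq = ∣m+n∣m⇒∣n (subst (_∣ t * e + suc r) gcd≡e (gcd[m,n]∣m _ _)) (n∣m*n t)
      where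
      gcd≡e : gcd (t * e + suc r) (d * e) ≡ e
      gcd≡e = *-cancelʳ-≡ _ e d (trans eq (*-comm d e))
  misaligned-sum : ∀ t → Σ< e′ (λ r → cofactor t (suc r)) ≡ 0
  misaligned-sum t = trans (Σ<-cong e′ (misaligned t)) (Σ<-zero e′)

cofactor-count : ∀ n d → .{{NonZero n}} → Σ< n (λ k → hasCofactor n k d) ≡ ι (d ∣? n) * φ d
cofactor-count n d with d ∣? n
... | yes (divides e refl) = begin
  Σ< (e * d) (λ k → hasCofactor (e * d) k d) ≡⟨ cong (λ m → Σ< m (λ k → hasCofactor m k d)) (*-comm e d) ⟩
  Σ< (d * e) (λ k → hasCofactor (d * e) k d) ≡⟨ cofactor-class d e ⟩
  φ d                                        ≡⟨ +-identityʳ (φ d) ⟨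
  φ d + 0                                    ∎
  where
  open ≡-Reasoning
  instance
    _ = m*n≢0⇒m≢0 e
    _ = m*n≢0⇒n≢0 e
... | no d∤n = trans (Σ<-cong′ n (λ k → ι-no _ (λ eq → d∤n (divides (gcd k n) (sym eq))))) (Σ<-zero n)

Σ∣-φ : ∀ n → .{{NonZero n}} → Σ∣ n φ ≡ n
Σ∣-φ n = begin
  Σ∣ n φ                                            ≡⟨ Σ<-cong′ n (λ j → cofactor-count n (suc j)) ⟨
  Σ< n (λ j → Σ< n (λ k → hasCofactor n k (suc j))) ≡⟨ Σ<-swap n n _ ⟨
  Σ< n (λ k → Σ< n (λ j → hasCofactor n k (suc j))) ≡⟨ Σ<-cong′ n (λ k → cofactor-unique n k) ⟩
  Σ< n (λ _ → 1)                                    ≡⟨ Σ<-one n ⟩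
  n                                                 ∎
  where open ≡-Reasoning

Σ∣-restrict : ∀ a m (f : ℕ → ℕ) → .{{NonZero m}} →
              Σ∣ m (λ d → ι (d ∣? a) * f d) ≡ Σ∣ (gcd a m) f
Σ∣-restrict a m f = begin
  Σ∣ m (λ d → ι (d ∣? a) * f d)          ≡⟨ Σ<-cong′ m common-divisor ⟩
  Σ< m G                                 ≡⟨ cong (λ n → Σ< n G) (m+[n∸m]≡n (gcd[m,n]≤n a m)) ⟨
  Σ< (g + (m ∸ g)) G                     ≡⟨ Σ<-+ g (m ∸ g) G ⟩
  Σ∣ g f + Σ< (m ∸ g) (λ k → G (g + k))  ≡⟨ cong (Σ∣ g f +_) (trans (Σ<-cong′ (m ∸ g) beyond-g)
                                                                    (Σ<-zero (m ∸ g))) ⟩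
  Σ∣ g f + 0                             ≡⟨ +-identityʳ (Σ∣ g f) ⟩
  Σ∣ g f                                 ∎
  where
  open ≡-Reasoning
  g = gcd a m
  instance _ = gcd≢0ʳ a m
  G : ℕ → ℕ
  G j = ι (suc j ∣? g) * f (suc j)
  divides-both : ∀ d → ι (d ∣? m) * ι (d ∣? a) ≡ ι (d ∣? g)
  divides-both d = trans (sym (ι-× (d ∣? m) (d ∣? a)))
    (ι-cong ((d ∣? m) ×-dec (d ∣? a)) (d ∣? g)
            (λ (d∣m , d∣a) → gcd-greatest d∣a d∣m)
            (λ d∣g → ∣-trans d∣g (gcd[m,n]∣n a m) , ∣-trans d∣g (gcd[m,n]∣m a m)))
  common-divisor : ∀ j → ι (suc j ∣? m) * (ι (suc j ∣? a) * f (suc j)) ≡ G j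
  common-divisor j = trans (sym (*-assoc (ι (suc j ∣? m)) _ _))
                           (cong (_* f (suc j)) (divides-both (suc j)))
  beyond-g : ∀ k → G (g + k) ≡ 0
  beyond-g k = cong (_* f (suc (g + k)))
    (ι-no (suc (g + k) ∣? g) (λ ∣g → <⇒≱ (s≤s (m≤m+n g k)) (∣⇒≤ ∣g)))

gcd-as-divisor-sum : ∀ a m → .{{NonZero m}} → gcd a m ≡ Σ∣ m (λ d → ι (d ∣? a) * φ d)
gcd-as-divisor-sum a m = sym (trans (Σ∣-restrict a m φ) (Σ∣-φ (gcd a m)))
  where instance _ = gcd≢0ʳ a m

|eval| : Poly → ℕ → ℕ
|eval| g k = ℤ.∣ evalℕ g k ∣

eval-shift : ∀ g X D S → ∃ λ q → eval g (X ℤ.+ D ℤ.* S) ≡ eval g X ℤ.+ D ℤ.* q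
eval-shift []       X D S = ℤ.+ 0 , zero-shift D
  where
  zero-shift : ∀ D → ℤ.+ 0 ≡ ℤ.+ 0 ℤ.+ D ℤ.* ℤ.+ 0
  zero-shift = ℤ-Solver.solve-∀
eval-shift (a ∷ as) X D S with (q , eq) ← eval-shift as X D S =
  X ℤ.* q ℤ.+ S ℤ.* eval as X ℤ.+ S ℤ.* D ℤ.* q , (begin
  a ℤ.+ (X ℤ.+ D ℤ.* S) ℤ.* eval as (X ℤ.+ D ℤ.* S) ≡⟨ cong (λ z → a ℤ.+ (X ℤ.+ D ℤ.* S) ℤ.* z) eq ⟩
  a ℤ.+ (X ℤ.+ D ℤ.* S) ℤ.* (eval as X ℤ.+ D ℤ.* q) ≡⟨ expand a X D S (eval as X) q ⟩
  a ℤ.+ X ℤ.* eval as X ℤ.+ D ℤ.* (X ℤ.* q ℤ.+ S ℤ.* eval as X ℤ.+ S ℤ.* D ℤ.* q) ∎)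
  where
  open ≡-Reasoning
  expand : ∀ a X D S E q → a ℤ.+ (X ℤ.+ D ℤ.* S) ℤ.* (E ℤ.+ D ℤ.* q) ≡
                           a ℤ.+ X ℤ.* E ℤ.+ D ℤ.* (X ℤ.* q ℤ.+ S ℤ.* E ℤ.+ S ℤ.* D ℤ.* q)
  expand = ℤ-Solver.solve-∀

∣-eval-periodic : ∀ g {d L} → d ∣ L → ∀ t r → d ∣ |eval| g (t * L + r) ⇔ d ∣ |eval| g r
∣-eval-periodic g {d} (divides c refl) t r
  with (q , g[r+dq]≡) ← eval-shift g (ℤ.+ r) (ℤ.+ d) (ℤ.+ (t * c)) = mk⇔ to from
  where
  regroup : ∀ t c d r → t * (c * d) + r ≡ r + d * (t * c)
  regroup = solve-∀
  as-integer : ℤ.+ (t * (c * d) + r) ≡ ℤ.+ r ℤ.+ ℤ.+ d ℤ.* ℤ.+ (t * c)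
  as-integer = trans (cong ℤ.+_ (regroup t c d r))
                     (trans (ℤ.pos-+ r (d * (t * c))) (cong (λ z → ℤ.+ r ℤ.+ z) (ℤ.pos-* d (t * c))))
  g[tL+r] : evalℕ g (t * (c * d) + r) ≡ evalℕ g r ℤ.+ ℤ.+ d ℤ.* q
  g[tL+r] = trans (cong (eval g) as-integer) g[r+dq]≡
  d∣dq : ℤ.+ d ℤ∣.∣ ℤ.+ d ℤ.* q
  d∣dq = ℤ∣.∣m⇒∣m*n q ℤ∣.∣-refl
  to : d ∣ |eval| g (t * (c * d) + r) → d ∣ |eval| g r
  to d∣g[tL+r] = ℤ∣.∣⇒∣ᵤ {i = evalℕ g r}
    (ℤ∣.∣m+n∣n⇒∣m {m = evalℕ g r} (subst (ℤ.+ d ℤ∣.∣_) g[tL+r] (ℤ∣.∣ᵤ⇒∣ d∣g[tL+r])) d∣dq)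
  from : d ∣ |eval| g r → d ∣ |eval| g (t * (c * d) + r)
  from d∣g[r] = ℤ∣.∣⇒∣ᵤ {i = evalℕ g (t * (c * d) + r)}
    (subst (ℤ.+ d ℤ∣.∣_) (sym g[tL+r]) (ℤ∣.∣m∣n⇒∣m+n {m = evalℕ g r} (ℤ∣.∣ᵤ⇒∣ d∣g[r]) d∣dq))

divides-eval-periodic : ∀ g {d L} → d ∣ L → Periodic L (λ k → ι (d ∣? |eval| g k))
divides-eval-periodic g {d} d∣L t r = ι-cong (d ∣? _) (d ∣? _) to from
  where open Equivalence (∣-eval-periodic g d∣L t r)

gcd-eval-periodic : ∀ g m {L} → m ∣ L → Periodic L (λ k → gcd (|eval| g k) m)
gcd-eval-periodic g m m∣L t r = gcd-cong _ _ m (λ c c∣m → ∣-eval-periodic g (∣-trans c∣m m∣L) t r)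

Σ∣² : ℕ → ℕ → (ℕ → ℕ → ℕ) → ℕ
Σ∣² m₁ m₂ f = Σ∣ m₁ (λ d₁ → Σ∣ m₂ (f d₁))

Σ∣²-cong : ∀ m₁ m₂ {f g : ℕ → ℕ → ℕ} →
           (∀ d₁ d₂ → d₁ ∣ m₁ → d₂ ∣ m₂ → .{{NonZero d₁}} → .{{NonZero d₂}} → f d₁ d₂ ≡ g d₁ d₂) →
           Σ∣² m₁ m₂ f ≡ Σ∣² m₁ m₂ g
Σ∣²-cong m₁ m₂ eq =
  Σ∣-cong m₁ (λ d₁ d₁∣m₁ → Σ∣-cong m₂ (λ d₂ d₂∣m₂ → eq d₁ d₂ d₁∣m₁ d₂∣m₂))

Σ∣²-*ˡ : ∀ m₁ m₂ c (f : ℕ → ℕ → ℕ) → Σ∣² m₁ m₂ (λ d₁ d₂ → c * f d₁ d₂) ≡ c * Σ∣² m₁ m₂ f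
Σ∣²-*ˡ m₁ m₂ c f = trans (Σ∣-cong m₁ (λ d₁ _ → sym (Σ∣-*ˡ m₂ c (f d₁))))
                         (sym (Σ∣-*ˡ m₁ c (λ d₁ → Σ∣ m₂ (f d₁))))

bothDivide : Poly → Poly → ℕ → ℕ → ℕ → ℕ
bothDivide g₁ g₂ d₁ d₂ k = ι (d₁ ∣? |eval| g₁ k) * ι (d₂ ∣? |eval| g₂ k)

bothDivide-periodic : ∀ g₁ g₂ d₁ d₂ → Periodic (lcm d₁ d₂) (bothDivide g₁ g₂ d₁ d₂)
bothDivide-periodic g₁ g₂ d₁ d₂ = Periodic-* (divides-eval-periodic g₁ (m∣lcm[m,n] d₁ d₂))
                                             (divides-eval-periodic g₂ (n∣lcm[m,n] d₁ d₂))

-- η_G(d₁,d₂) = S_L(P_{d₁d₂}) for L = lcm[d₁,d₂], since x is prime to d₁ and to d₂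
-- iff it is prime to L.
η-as-reducedSum : ∀ g₁ g₂ d₁ d₂ →
                  η g₁ g₂ d₁ d₂ ≡ reducedSum (lcm d₁ d₂) (bothDivide g₁ g₂ d₁ d₂)
η-as-reducedSum g₁ g₂ d₁ d₂ = begin
  η g₁ g₂ d₁ d₂                                     ≡⟨ length≡sum-ones (filter counted? (upTo L)) ⟩
  sum (map (λ _ → 1) (filter counted? (upTo L)))    ≡⟨ sum-filter L (λ x → x) (λ _ → 1) counted? ⟩
  Σ< L (λ k → ι (counted? k) * 1)                   ≡⟨ Σ<-cong′ L indicator ⟩
  reducedSum L (bothDivide g₁ g₂ d₁ d₂)             ∎
  where
  open ≡-Reasoning
  L = lcm d₁ d₂
  divides₁? : (k : ℕ) → Dec (d₁ ∣ |eval| g₁ k)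
  divides₁? k = d₁ ∣? |eval| g₁ k
  divides₂? : (k : ℕ) → Dec (d₂ ∣ |eval| g₂ k)
  divides₂? k = d₂ ∣? |eval| g₂ k
  coprime? : (k : ℕ) → Dec (gcd k d₁ ≡ 1 × gcd k d₂ ≡ 1)
  coprime? k = (gcd k d₁ ≟ 1) ×-dec (gcd k d₂ ≟ 1)
  counted? : Decidable (λ k → d₁ ∣ |eval| g₁ k × d₂ ∣ |eval| g₂ k × gcd k d₁ ≡ 1 × gcd k d₂ ≡ 1)
  counted? k = divides₁? k ×-dec divides₂? k ×-dec coprime? k
  coprime-to-L : ∀ k → ι (coprime? k) ≡ χ L k
  coprime-to-L k = ι-cong (coprime? k) (gcd k L ≟ 1) to from
    where
    to : gcd k d₁ ≡ 1 × gcd k d₂ ≡ 1 → gcd k L ≡ 1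
    to (e₁ , e₂) = coprime⇒gcd≡1
      (Equivalence.from (coprime-lcm k d₁ d₂) (gcd≡1⇒coprime e₁ , gcd≡1⇒coprime e₂))
    from : gcd k L ≡ 1 → gcd k d₁ ≡ 1 × gcd k d₂ ≡ 1
    from e with (c₁ , c₂) ← Equivalence.to (coprime-lcm k d₁ d₂) (gcd≡1⇒coprime e) =
      coprime⇒gcd≡1 c₁ , coprime⇒gcd≡1 c₂
  rearrange : ∀ a b u → a * (b * u) * 1 ≡ u * (a * b)
  rearrange = solve-∀
  indicator : ∀ k → ι (counted? k) * 1 ≡ χ L k * bothDivide g₁ g₂ d₁ d₂ k
  indicator k = begin
    ι (counted? k) * 1                        ≡⟨ cong (_* 1) (ι-× (divides₁? k) _) ⟩
    i₁ * ι (divides₂? k ×-dec coprime? k) * 1 ≡⟨ cong (λ z → i₁ * z * 1) (ι-× (divides₂? k) _) ⟩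
    i₁ * (i₂ * ι (coprime? k)) * 1            ≡⟨ cong (λ z → i₁ * (i₂ * z) * 1) (coprime-to-L k) ⟩
    i₁ * (i₂ * χ L k) * 1                     ≡⟨ rearrange i₁ i₂ (χ L k) ⟩
    χ L k * bothDivide g₁ g₂ d₁ d₂ k          ∎
    where
    i₁ = ι (divides₁? k)
    i₂ = ι (divides₂? k)

gcdProduct : Poly → Poly → ℕ → ℕ → ℕ → ℕ
gcdProduct g₁ g₂ m₁ m₂ k = gcd (|eval| g₁ k) m₁ * gcd (|eval| g₂ k) m₂

-- Summing over 1 ≤ k ≤ M instead of 0 ≤ k < M changes nothing, as H is periodic mod M.
lhsSum-as-reducedSum : ∀ g₁ g₂ m₁ m₂ M → m₁ ∣ M → m₂ ∣ M →
                       lhsSum g₁ g₂ m₁ m₂ M ≡ reducedSum M (gcdProduct g₁ g₂ m₁ m₂)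
lhsSum-as-reducedSum g₁ g₂ m₁ m₂ M m₁∣M m₂∣M = begin
  lhsSum g₁ g₂ m₁ m₂ M                            ≡⟨ cong (sum ∘ map H ∘ filter coprime?) (map-upTo suc M) ⟩
  sum (map H (filter coprime? (applyUpTo suc M))) ≡⟨ sum-filter M suc H coprime? ⟩
  Σ< M (λ k → χ M (suc k) * H (suc k))            ≡⟨ Σ<-rotate M (λ k → χ M k * H k) at-0≡at-M ⟩
  reducedSum M H                                  ∎
  where
  open ≡-Reasoning
  H = gcdProduct g₁ g₂ m₁ m₂
  coprime? : Decidable (λ k → gcd k M ≡ 1)
  coprime? k = gcd k M ≟ 1
  H-periodic : Periodic M H
  H-periodic = Periodic-* (gcd-eval-periodic g₁ m₁ m₁∣M) (gcd-eval-periodic g₂ m₂ m₂∣M)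
  at-0≡at-M : χ M 0 * H 0 ≡ χ M M * H M
  at-0≡at-M = cong₂ _*_ (χ-period M) (sym (Periodic-at-period H-periodic))

rhsSum-as-Σ∣² : ∀ g₁ g₂ m₁ m₂ → rhsSum g₁ g₂ m₁ m₂ ≡
  Σ∣² m₁ m₂ (λ d₁ d₂ → φ (gcd d₁ d₂) * reducedSum (lcm d₁ d₂) (bothDivide g₁ g₂ d₁ d₂))
rhsSum-as-Σ∣² g₁ g₂ m₁ m₂ = trans (sumDivisors-as-Σ∣ m₁ _) (Σ∣-cong m₁ (λ d₁ _ →
  trans (sumDivisors-as-Σ∣ m₂ (λ d₂ → φ (gcd d₁ d₂) * η g₁ g₂ d₁ d₂))
        (Σ∣-cong m₂ (λ d₂ _ → cong (φ (gcd d₁ d₂) *_) (η-as-reducedSum g₁ g₂ d₁ d₂)))))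

reducedSum-gcdProduct : ∀ g₁ g₂ m₁ m₂ M → .{{NonZero m₁}} → .{{NonZero m₂}} →
  reducedSum M (gcdProduct g₁ g₂ m₁ m₂) ≡
  Σ∣² m₁ m₂ (λ d₁ d₂ → φ d₁ * φ d₂ * reducedSum M (bothDivide g₁ g₂ d₁ d₂))
reducedSum-gcdProduct g₁ g₂ m₁ m₂ M = begin
  Σ< M (λ k → χ M k * gcdProduct g₁ g₂ m₁ m₂ k)       ≡⟨ Σ<-cong′ M expand ⟩
  Σ< M (λ k → Σ∣² m₁ m₂ (λ d₁ d₂ → term d₁ d₂ k))
    ≡⟨ Σ<-Σ∣-swap M m₁ (λ k d₁ → Σ∣ m₂ (λ d₂ → term d₁ d₂ k)) ⟩
  Σ∣ m₁ (λ d₁ → Σ< M (λ k → Σ∣ m₂ (λ d₂ → term d₁ d₂ k)))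
    ≡⟨ Σ∣-cong m₁ (λ d₁ _ → Σ<-Σ∣-swap M m₂ (λ k d₂ → term d₁ d₂ k)) ⟩
  Σ∣² m₁ m₂ (λ d₁ d₂ → Σ< M (term d₁ d₂))
    ≡⟨ Σ∣²-cong m₁ m₂ (λ d₁ d₂ _ _ → Σ<-*ˡ M (φ d₁ * φ d₂) (λ k → χ M k * bothDivide g₁ g₂ d₁ d₂ k)) ⟩
  Σ∣² m₁ m₂ (λ d₁ d₂ → φ d₁ * φ d₂ * reducedSum M (bothDivide g₁ g₂ d₁ d₂)) ∎
  where
  open ≡-Reasoning
  term : ℕ → ℕ → ℕ → ℕ
  term d₁ d₂ k = φ d₁ * φ d₂ * (χ M k * bothDivide g₁ g₂ d₁ d₂ k)
  gaussTerm : Poly → ℕ → ℕ → ℕ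
  gaussTerm g k d = ι (d ∣? |eval| g k) * φ d
  rearrange : ∀ c i₁ f₁ i₂ f₂ → c * ((i₁ * f₁) * (i₂ * f₂)) ≡ f₁ * f₂ * (c * (i₁ * i₂))
  rearrange = solve-∀
  expand : ∀ k → χ M k * gcdProduct g₁ g₂ m₁ m₂ k ≡ Σ∣² m₁ m₂ (λ d₁ d₂ → term d₁ d₂ k)
  expand k = begin
    χ M k * (gcd (|eval| g₁ k) m₁ * gcd (|eval| g₂ k) m₂)
      ≡⟨ cong (χ M k *_) (cong₂ _*_ (gcd-as-divisor-sum (|eval| g₁ k) m₁)
                                   (gcd-as-divisor-sum (|eval| g₂ k) m₂)) ⟩
    χ M k * (Σ∣ m₁ (gaussTerm g₁ k) * Σ∣ m₂ (gaussTerm g₂ k))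
      ≡⟨ cong (χ M k *_) (Σ∣-product m₁ m₂ (gaussTerm g₁ k) (gaussTerm g₂ k)) ⟩
    χ M k * Σ∣² m₁ m₂ (λ d₁ d₂ → gaussTerm g₁ k d₁ * gaussTerm g₂ k d₂)
      ≡⟨ Σ∣²-*ˡ m₁ m₂ (χ M k) (λ d₁ d₂ → gaussTerm g₁ k d₁ * gaussTerm g₂ k d₂) ⟨
    Σ∣² m₁ m₂ (λ d₁ d₂ → χ M k * (gaussTerm g₁ k d₁ * gaussTerm g₂ k d₂))
      ≡⟨ Σ∣²-cong m₁ m₂ (λ d₁ d₂ _ _ → rearrange (χ M k) (ι (d₁ ∣? |eval| g₁ k)) (φ d₁)
                                                         (ι (d₂ ∣? |eval| g₂ k)) (φ d₂)) ⟩
    Σ∣² m₁ m₂ (λ d₁ d₂ → term d₁ d₂ k) ∎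

corollary8 : (g₁ g₂ : Poly) (m₁ m₂ M : ℕ) → NonZero m₁ → NonZero m₂ → NonZero M →
    lcm m₁ m₂ ∣ M →
    lhsSum g₁ g₂ m₁ m₂ M ≡ φ M * rhsSum g₁ g₂ m₁ m₂
corollary8 g₁ g₂ m₁ m₂ M m₁≢0 m₂≢0 M≢0 lcm∣M = begin
  lhsSum g₁ g₂ m₁ m₂ M                                  ≡⟨ lhsSum-as-reducedSum g₁ g₂ m₁ m₂ M m₁∣M m₂∣M ⟩
  reducedSum M (gcdProduct g₁ g₂ m₁ m₂)                 ≡⟨ reducedSum-gcdProduct g₁ g₂ m₁ m₂ M ⟩
  Σ∣² m₁ m₂ (λ d₁ d₂ → φ d₁ * φ d₂ * reducedSum M (P d₁ d₂)) ≡⟨ Σ∣²-cong m₁ m₂ pair-term ⟩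
  Σ∣² m₁ m₂ (λ d₁ d₂ → φ M * η-term d₁ d₂)              ≡⟨ Σ∣²-*ˡ m₁ m₂ (φ M) η-term ⟩
  φ M * Σ∣² m₁ m₂ η-term                                ≡⟨ cong (φ M *_) (rhsSum-as-Σ∣² g₁ g₂ m₁ m₂) ⟨
  φ M * rhsSum g₁ g₂ m₁ m₂                              ∎
  where
  open ≡-Reasoning
  instance _ = m₁≢0 ; _ = m₂≢0 ; _ = M≢0
  P = bothDivide g₁ g₂
  η-term : ℕ → ℕ → ℕ
  η-term d₁ d₂ = φ (gcd d₁ d₂) * reducedSum (lcm d₁ d₂) (P d₁ d₂)
  m₁∣M = ∣-trans (m∣lcm[m,n] m₁ m₂) lcm∣M
  m₂∣M = ∣-trans (n∣lcm[m,n] m₁ m₂) lcm∣M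
  pair-term : ∀ d₁ d₂ → d₁ ∣ m₁ → d₂ ∣ m₂ → .{{NonZero d₁}} → .{{NonZero d₂}} →
              φ d₁ * φ d₂ * reducedSum M (P d₁ d₂) ≡ φ M * η-term d₁ d₂
  pair-term d₁ d₂ d₁∣m₁ d₂∣m₂ = divisor-pair-term d₁ d₂ M (P d₁ d₂)
    (lcm-least (∣-trans d₁∣m₁ m₁∣M) (∣-trans d₂∣m₂ m₂∣M)) (bothDivide-periodic g₁ g₂ d₁ d₂)
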